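{- Let $d,\delta$ be positive integers with $D=d+\delta$, let $\mathcal U\subseteq\{ -1,0,1\}^d\setminus\{0^d\}$, $\mathcal V\subseteq\{ -1,0,1\}^d$, $\mathcal T\subseteq\{ -1,0,1\}^\delta\setminus\{0^\delta\}$, and $\mathcal S=(\mathcal U\times\{0^\delta\})\cup(\mathcal V\times\mathcal T)$. Let $T(x_{d+1},\dots,x_D)=\sum_{(i_{d+1},\dots,i_D)\in\mathcal T}x_{d+1}^{i_{d+1}}\cdots x_D^{i_D}$ and let $$C_1(x_1,\dots,x_d,v;t)=\sum_w x_1^{i_1(w)}\cdots x_d^{i_d(w)}(1+v)^{|w|_{\mathcal U\cap\mathcal V}}v^{|w|_{\mathcal V\setminus\mathcal U}}t^{|w|},$$ the sum running over all walks $w$ starting at the origin with steps in $\mathcal U\cup\mathcal V$ confined to $\mathbb N^d$, with endpoint $(i_1(w),\dots,i_d(w))$, length $|w|$, and $|w|_{\mathcal W}$ the number of its steps in $\mathcal W$. Then the generating function of walks starting at the origin with steps in $\mathcal S$ that are confined to $\mathbb N^d\times\mathbb Z^\delta$, counted by the length ($t$) and the coordinates $x_1,\dots,x_D$ of the endpoint, equals $C_1(x_1,\dots,x_d,T(x_{d+1},\dots,x_D);t)$.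
   Context: $0^i$ denotes the $i$-tuple $(0,\dots,0)$. A walk is confined to a region if all its visited points lie in that region. -}

module Defs where

open import Data.Bool using (Bool; true; false; _∧_; _∨_; not)
open import Data.Nat as ℕ using (ℕ; zero; suc; _+_)
open import Data.Integer as ℤ using (ℤ; +_; -[1+_]; 0ℤ; 1ℤ; -1ℤ)
open import Data.List as L using (List; []; _∷_; _++_; map; concatMap; length; filterᵇ)
open import Data.Vec as V using (Vec; []; _∷_; zipWith; replicate; take; toList)
open import Data.Vec.Properties using (≡-dec)
open import Data.Vec.Relation.Unary.All as VAll using ()
open import Data.Sum using (_⊎_)
open import Relation.Binary.PropositionalEquality using (_≡_)
open import Relation.Nullary.Decidable using (⌊_⌋)

Pt : ℕ → Set
Pt k = Vec ℤ k

origin : ∀ {k} → Pt k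
origin {k} = replicate k 0ℤ

_⊕_ : ∀ {k} → Pt k → Pt k → Pt k
_⊕_ = zipWith ℤ._+_

_==_ : ∀ {k} → Pt k → Pt k → Bool
p == q = ⌊ ≡-dec ℤ._≟_ p q ⌋

_∈ᵇ_ : ∀ {k} → Pt k → List (Pt k) → Bool
p ∈ᵇ []       = false
p ∈ᵇ (q ∷ qs) = (p == q) ∨ (p ∈ᵇ qs)

IsSmallStep : ∀ {k} → Pt k → Set
IsSmallStep = VAll.All (λ z → z ≡ -1ℤ ⊎ (z ≡ 0ℤ ⊎ z ≡ 1ℤ))

-- Walks of length n with steps in a finite step set (list without
-- duplicates): all sequences of n steps.

seqs : ∀ {A : Set} (n : ℕ) → List A → List (Vec A n)
seqs zero    L = [] ∷ []
seqs (suc n) L = concatMap (λ x → map (x ∷_) (seqs n L)) L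

endpoint : ∀ {k n} → Vec (Pt k) n → Pt k
endpoint []      = origin
endpoint (s ∷ w) = s ⊕ endpoint w

confinedFrom : ∀ {k n} → (Pt k → Bool) → Pt k → Vec (Pt k) n → Bool
confinedFrom P p []      = P p
confinedFrom P p (s ∷ w) = P p ∧ confinedFrom P (p ⊕ s) w

confined : ∀ {k n} → (Pt k → Bool) → Vec (Pt k) n → Bool
confined P w = confinedFrom P origin w

natᵇ : ℤ → Bool
natᵇ (+ _)      = true
natᵇ -[1+ _ ]   = false

allNatᵇ : ∀ {k} → Pt k → Bool
allNatᵇ []       = true
allNatᵇ (z ∷ zs) = natᵇ z ∧ allNatᵇ zs

inQuadrant : ∀ {d} → Pt d → Bool
inQuadrant = allNatᵇ

inHalf : ∀ d {δ} → Pt (d + δ) → Bool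
inHalf d p = allNatᵇ (take d p)

countSteps : ∀ {A : Set} {n} → (A → Bool) → Vec A n → ℕ
countSteps P w = length (filterᵇ P (toList w))

-- Polynomials with ℕ coefficients, represented as multisets (lists) of
-- monomials; the coefficient of a monomial is its multiplicity.

MPoly : Set → Set
MPoly M = List M

pmul : ∀ {M : Set} → (M → M → M) → MPoly M → MPoly M → MPoly M
pmul _∙_ p q = concatMap (λ m → map (m ∙_) q) p

ppow : ∀ {M : Set} → (M → M → M) → M → MPoly M → ℕ → MPoly M
ppow _∙_ ε p zero    = ε ∷ []
ppow _∙_ ε p (suc e) = pmul _∙_ p (ppow _∙_ ε p e)

-- coefficient of the monomial y^b in a Laurent polynomial in δ variables
coeffY : ∀ {δ} → Pt δ → MPoly (Pt δ) → ℕ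
coeffY b p = length (filterᵇ (_== b) p)

-- polynomials in one variable v: monomial v^e represented by e : ℕ
onePlusV : MPoly ℕ
onePlusV = 0 ∷ 1 ∷ []

-- substitution v := T for a polynomial in v, T a Laurent polynomial in y
substV : ∀ {δ} → MPoly (Pt δ) → MPoly ℕ → MPoly (Pt δ)
substV T p = concatMap (ppow _⊕_ origin T) p

stepSetS : ∀ {d δ} → List (Pt d) → List (Pt d) → List (Pt δ) → List (Pt (d + δ))
stepSetS U Vs T = map (λ u → u V.++ origin) U ++ concatMap (λ v → map (v V.++_) T) Vs

unionUV : ∀ {d} → List (Pt d) → List (Pt d) → List (Pt d)
unionUV U Vs = U ++ filterᵇ (λ v → not (v ∈ᵇ U)) Vs

-- coefficient of t^n x_1^{a_1} ... x_D^{a_D} in the generating function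
-- of walks from the origin with steps in S confined to ℕ^d × ℤ^δ
-- (the exponent of x_{d+1},...,x_D is b)
walkCoeffS : ∀ {d δ} → List (Pt d) → List (Pt d) → List (Pt δ) →
             ℕ → Pt d → Pt δ → ℕ
walkCoeffS {d} U Vs T n a b =
  length (filterᵇ (λ w → confined (inHalf d) w ∧ (endpoint w == (a V.++ b)))
                  (seqs n (stepSetS U Vs T)))

-- coefficient of t^n x_1^{a_1}...x_d^{a_d} in C_1(x_1,...,x_d,v;t),
-- a polynomial in v
C1coeff : ∀ {d} → List (Pt d) → List (Pt d) → ℕ → Pt d → MPoly ℕ
C1coeff U Vs n a =
  concatMap
    (λ w → pmul _+_ (ppow _+_ 0 onePlusV
                            (countSteps (λ s → (s ∈ᵇ U) ∧ (s ∈ᵇ Vs)) w))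
                     (countSteps (λ s → (s ∈ᵇ Vs) ∧ not (s ∈ᵇ U)) w ∷ []))
    (filterᵇ (λ w → confined inQuadrant w ∧ (endpoint w == a))
             (seqs n (unionUV U Vs)))

-- coefficient of t^n x^a y^b in C_1(x, T(y); t)
C1TCoeff : ∀ {d δ} → List (Pt d) → List (Pt d) → List (Pt δ) →
           ℕ → Pt d → Pt δ → ℕ
C1TCoeff U Vs T n a b = coeffY b (substV T (C1coeff U Vs n a))

module Submission where

-- Both sides of the identity satisfy the same first-step recursion, so they
-- agree by induction on the length n, once the statement is generalised from
-- walks starting at the origin to walks starting at an arbitrary point (p, q).
--
--  * An S-walk from (p, q) confined to ℕ^d × ℤ^δ first checks that p ∈ ℕ^d and
--    then takes either a step (u, 0^δ) with u ∈ U or a step (v, t) with v ∈ V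
--    and t ∈ T.
--  * A quadrant walk with steps in U ∪ V carries the weight
--    (1+v)^{|w|_{U∩V}} v^{|w|_{V∖U}}; a first step x contributes the factor 1,
--    v or 1+v, so after substituting v := T the coefficient of y^b in y^q·(…)
--    splits as [x ∈ U]·(rest from q) + [x ∈ V]·Σ_{t ∈ T} (rest from q + t).
--  * A sum over U ∪ V with multiplicities [x ∈ U] and [x ∈ V] is a sum over U
--    plus a sum over V when U and V are duplicate-free, which matches the
--    first-step decomposition of the S-walks.

open import Defs
open import Data.Nat using (ℕ; _≤_; _+_)
open import Data.List using (List)
open import Data.List.Relation.Unary.All using (All)
open import Data.List.Relation.Unary.Unique.Propositional using (Unique)
open import Data.List.Membership.Propositional using (_∉_)
open import Relation.Binary.PropositionalEquality using (_≡_)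

open import Data.Nat using (zero; suc; _*_)
open import Data.Nat.Properties using (+-assoc; +-identityʳ; +-suc; *-assoc; *-identityʳ; *-zeroʳ; *-distribˡ-+)
open import Data.Nat.Tactic.RingSolver using (solve-∀)
open import Data.Bool using (Bool; true; false; _∧_; _∨_; not)
open import Data.Bool.Properties using (∧-assoc; ∨-zeroʳ)
open import Data.Integer as ℤ using ()
import Data.Integer.Properties as ℤP
open import Data.List using ([]; _∷_; _++_; map; concatMap; length; filterᵇ)
open import Data.List.Relation.Unary.All using ([]; _∷_) renaming (map to All-map)
open import Data.List.Relation.Unary.All.Properties using (++⁺)
open import Data.List.Relation.Unary.AllPairs using ([]; _∷_)
open import Data.Vec as V using (Vec; []; _∷_; take)
open import Data.Vec.Properties using (≡-dec; ++-injective; zipWith-++)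
open import Data.Vec.Properties using (zipWith-assoc; zipWith-identityˡ; zipWith-identityʳ)
open import Data.Product using (_×_; _,_; proj₁; proj₂)
open import Data.Empty using (⊥-elim)
open import Relation.Nullary using (Dec; yes; no)
open import Relation.Nullary.Reflects using (Reflects; ofʸ; ofⁿ)
open import Relation.Nullary.Decidable using (⌊_⌋)
open import Relation.Binary.PropositionalEquality using (_≢_; refl; sym; trans; cong; cong₂)
open Relation.Binary.PropositionalEquality.≡-Reasoning

-- Indicators and finite sums over lists

𝟙 : Bool → ℕ
𝟙 true  = 1
𝟙 false = 0

𝟙-∧ : ∀ x y → 𝟙 (x ∧ y) ≡ 𝟙 x * 𝟙 y
𝟙-∧ true  y = sym (+-identityʳ (𝟙 y))
𝟙-∧ false y = refl

𝟙-split : ∀ x n → 𝟙 x * n + 𝟙 (not x) * n ≡ n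
𝟙-split true  n = trans (+-identityʳ _) (+-identityʳ n)
𝟙-split false n = +-identityʳ n

sumL : ∀ {A : Set} → List A → (A → ℕ) → ℕ
sumL []       f = 0
sumL (x ∷ xs) f = f x + sumL xs f

infix 5 sumL
syntax sumL xs (λ x → e) = ∑[ x ← xs ] e

module _ {A : Set} where

  sum-cong : ∀ (xs : List A) {f g : A → ℕ} → (∀ x → f x ≡ g x) → sumL xs f ≡ sumL xs g
  sum-cong []       eq = refl
  sum-cong (x ∷ xs) eq = cong₂ _+_ (eq x) (sum-cong xs eq)

  sum-congAll : ∀ {xs : List A} {f g : A → ℕ} → All (λ x → f x ≡ g x) xs → sumL xs f ≡ sumL xs g
  sum-congAll []         = refl
  sum-congAll (eq ∷ eqs) = cong₂ _+_ eq (sum-congAll eqs)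

  sum-++ : ∀ (xs ys : List A) f → sumL (xs ++ ys) f ≡ sumL xs f + sumL ys f
  sum-++ []       ys f = refl
  sum-++ (x ∷ xs) ys f = trans (cong (f x +_) (sum-++ xs ys f)) (sym (+-assoc (f x) _ _))

  sum-zero : ∀ (xs : List A) → (∑[ x ← xs ] 0) ≡ 0
  sum-zero []       = refl
  sum-zero (x ∷ xs) = sum-zero xs

  sum-+ : ∀ (xs : List A) f g → (∑[ x ← xs ] f x + g x) ≡ sumL xs f + sumL xs g
  sum-+ []       f g = refl
  sum-+ (x ∷ xs) f g = trans (cong (f x + g x +_) (sum-+ xs f g)) (interchange (f x) (g x) _ _)
    where
    interchange : ∀ a b c e → a + b + (c + e) ≡ a + c + (b + e)
    interchange = solve-∀

  sum-* : ∀ (xs : List A) c f → (∑[ x ← xs ] c * f x) ≡ c * sumL xs f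
  sum-* []       c f = sym (*-zeroʳ c)
  sum-* (x ∷ xs) c f = trans (cong (c * f x +_) (sum-* xs c f)) (sym (*-distribˡ-+ c (f x) _))

  sum-filter : ∀ (P : A → Bool) xs f → sumL (filterᵇ P xs) f ≡ ∑[ x ← xs ] 𝟙 (P x) * f x
  sum-filter P []       f = refl
  sum-filter P (x ∷ xs) f with P x
  ... | true  = cong₂ _+_ (sym (+-identityʳ (f x))) (sum-filter P xs f)
  ... | false = sum-filter P xs f

  length-filter : ∀ (P : A → Bool) xs → length (filterᵇ P xs) ≡ ∑[ x ← xs ] 𝟙 (P x)
  length-filter P []       = refl
  length-filter P (x ∷ xs) with P x
  ... | true  = cong suc (length-filter P xs)
  ... | false = length-filter P xs

  filter-All : ∀ {Q : A → Set} (P : A → Bool) {xs} → All Q xs → All (λ x → P x ≡ true × Q x) (filterᵇ P xs)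
  filter-All P []                = []
  filter-All P {x ∷ _} (q ∷ qs) with P x in eq
  ... | true  = (eq , q) ∷ filter-All P qs
  ... | false = filter-All P qs

  countSteps-∷ : ∀ {n} (P : A → Bool) x (w : Vec A n) → countSteps P (x ∷ w) ≡ 𝟙 (P x) + countSteps P w
  countSteps-∷ P x w with P x
  ... | true  = refl
  ... | false = refl

module _ {A B : Set} where

  sum-map : ∀ (g : A → B) xs f → sumL (map g xs) f ≡ ∑[ x ← xs ] f (g x)
  sum-map g []       f = refl
  sum-map g (x ∷ xs) f = cong (f (g x) +_) (sum-map g xs f)

  sum-concatMap : ∀ (g : A → List B) xs f → sumL (concatMap g xs) f ≡ ∑[ x ← xs ] sumL (g x) f
  sum-concatMap g []       f = refl
  sum-concatMap g (x ∷ xs) f = trans (sum-++ (g x) (concatMap g xs) f) (cong (sumL (g x) f +_) (sum-concatMap g xs f))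

  sum-swap : ∀ (xs : List A) (ys : List B) (f : A → B → ℕ) →
    (∑[ x ← xs ] ∑[ y ← ys ] f x y) ≡ (∑[ y ← ys ] ∑[ x ← xs ] f x y)
  sum-swap []       ys f = sym (sum-zero ys)
  sum-swap (x ∷ xs) ys f = trans (cong (sumL ys (f x) +_) (sum-swap xs ys f)) (sym (sum-+ ys (f x) _))

sum-seqs-suc : ∀ {A : Set} n (L : List A) (g : Vec A (suc n) → ℕ) →
  sumL (seqs (suc n) L) g ≡ ∑[ x ← L ] ∑[ w ← seqs n L ] g (x ∷ w)
sum-seqs-suc n L g = trans (sum-concatMap (λ x → map (x ∷_) (seqs n L)) L g)
                           (sum-cong L (λ x → sum-map (x ∷_) (seqs n L) g))

reflects : ∀ {P : Set} (x : Dec P) → Reflects P ⌊ x ⌋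
reflects (yes p) = ofʸ p
reflects (no ¬p) = ofⁿ ¬p

module _ {k : ℕ} where

  ==-reflects : (p q : Pt k) → Reflects (p ≡ q) (p == q)
  ==-reflects p q = reflects (≡-dec ℤ._≟_ p q)

  ==-refl : (p : Pt k) → p == p ≡ true
  ==-refl p with p == p | ==-reflects p p
  ... | true  | _      = refl
  ... | false | ofⁿ ne = ⊥-elim (ne refl)

  ==-false : (p q : Pt k) → p ≢ q → p == q ≡ false
  ==-false p q ne with p == q | ==-reflects p q
  ... | false | _      = refl
  ... | true  | ofʸ eq = ⊥-elim (ne eq)

  ∈ᵇ-self : (L : List (Pt k)) → All (λ x → x ∈ᵇ L ≡ true) L
  ∈ᵇ-self []       = []
  ∈ᵇ-self (x ∷ xs) = cong (_∨ (x ∈ᵇ xs)) (==-refl x)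
    ∷ All-map (λ {y} e → trans (cong ((y == x) ∨_) e) (∨-zeroʳ (y == x))) (∈ᵇ-self xs)

  ∉ᵇ : (x : Pt k) (ys : List (Pt k)) → All (x ≢_) ys → x ∈ᵇ ys ≡ false
  ∉ᵇ x []       []         = refl
  ∉ᵇ x (y ∷ ys) (ne ∷ nes) = cong₂ _∨_ (==-false x y ne) (∉ᵇ x ys nes)

  ==-weight-sym : (x y : Pt k) (G : Pt k → ℕ) → 𝟙 (x == y) * G y ≡ 𝟙 (y == x) * G x
  ==-weight-sym x y G with x == y | ==-reflects x y | y == x | ==-reflects y x
  ... | true  | ofʸ refl | true  | _        = refl
  ... | true  | ofʸ refl | false | ofⁿ ne   = ⊥-elim (ne refl)
  ... | false | ofⁿ ne   | true  | ofʸ refl = ⊥-elim (ne refl)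
  ... | false | _        | false | _        = refl

  select : (L : List (Pt k)) → Unique L → (x : Pt k) (G : Pt k → ℕ) →
    (∑[ y ← L ] 𝟙 (x == y) * G y) ≡ 𝟙 (x ∈ᵇ L) * G x
  select []       []          x G = refl
  select (y ∷ ys) (y∉ys ∷ uL) x G with x == y | ==-reflects x y
  ... | false | _        = select ys uL x G
  ... | true  | ofʸ refl =
    trans (cong (G x + 0 +_) (trans (select ys uL x G) (cong (λ z → 𝟙 z * G x) (∉ᵇ x ys y∉ys))))
          (+-identityʳ _)

==-++ : ∀ {m n} (p p' : Pt m) (q q' : Pt n) → ((p V.++ q) == (p' V.++ q')) ≡ ((p == p') ∧ (q == q'))
==-++ p p' q q' with p == p' | ==-reflects p p' | q == q' | ==-reflects q q'
... | true  | ofʸ refl | true  | ofʸ refl = ==-refl (p V.++ q)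
... | true  | ofʸ refl | false | ofⁿ ne   = ==-false _ _ (λ e → ne (proj₂ (++-injective p p e)))
... | false | ofⁿ ne   | _     | _        = ==-false _ _ (λ e → ne (proj₁ (++-injective p p' e)))

⊕-assoc : ∀ {k} (p q r : Pt k) → (p ⊕ q) ⊕ r ≡ p ⊕ (q ⊕ r)
⊕-assoc = zipWith-assoc ℤP.+-assoc

⊕-identityˡ : ∀ {k} (p : Pt k) → origin ⊕ p ≡ p
⊕-identityˡ = zipWith-identityˡ ℤP.+-identityˡ

⊕-identityʳ : ∀ {k} (p : Pt k) → p ⊕ origin ≡ p
⊕-identityʳ = zipWith-identityʳ ℤP.+-identityʳ

⊕-++ : ∀ {m n} (p p' : Pt m) (q q' : Pt n) → (p V.++ q) ⊕ (p' V.++ q') ≡ (p ⊕ p') V.++ (q ⊕ q')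
⊕-++ p p' q q' = zipWith-++ ℤ._+_ p q p' q'

take-++ : ∀ {A : Set} {m n} (p : Vec A m) (q : Vec A n) → take m (p V.++ q) ≡ p
take-++ []      q = refl
take-++ (x ∷ p) q = cong (x ∷_) (take-++ p q)

origin-++ : ∀ m n → origin {m + n} ≡ origin {m} V.++ origin {n}
origin-++ zero    n = refl
origin-++ (suc m) n = cong (_ ∷_) (origin-++ m n)

-- Sums over the step sets S = (U × 0^δ) ∪ (V × T) and U ∪ V

sum-stepSetS : ∀ {d δ} (U V : List (Pt d)) (T : List (Pt δ)) (f : Pt (d + δ) → ℕ) →
  sumL (stepSetS U V T) f ≡ (∑[ u ← U ] f (u V.++ origin)) + (∑[ v ← V ] ∑[ t ← T ] f (v V.++ t))
sum-stepSetS U V T f =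
  trans (sum-++ (map (λ u → u V.++ origin) U) (concatMap (λ v → map (v V.++_) T) V) f)
        (cong₂ _+_ (sum-map (λ u → u V.++ origin) U f)
                   (trans (sum-concatMap (λ v → map (v V.++_) T) V f)
                          (sum-cong V (λ v → sum-map (v V.++_) T f))))

module _ {k : ℕ} (U V : List (Pt k)) (uU : Unique U) (uV : Unique V) where

  sum-∩ : (G : Pt k → ℕ) → (∑[ x ← U ] 𝟙 (x ∈ᵇ V) * G x) ≡ (∑[ y ← V ] 𝟙 (y ∈ᵇ U) * G y)
  sum-∩ G = begin
      (∑[ x ← U ] 𝟙 (x ∈ᵇ V) * G x)
    ≡⟨ sum-cong U (λ x → sym (select V uV x G)) ⟩
      (∑[ x ← U ] ∑[ y ← V ] 𝟙 (x == y) * G y)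
    ≡⟨ sum-swap U V (λ x y → 𝟙 (x == y) * G y) ⟩
      (∑[ y ← V ] ∑[ x ← U ] 𝟙 (x == y) * G y)
    ≡⟨ sum-cong V (λ y → sum-cong U (λ x → ==-weight-sym x y G)) ⟩
      (∑[ y ← V ] ∑[ x ← U ] 𝟙 (y == x) * G x)
    ≡⟨ sum-cong V (λ y → select U uU y G) ⟩
      (∑[ y ← V ] 𝟙 (y ∈ᵇ U) * G y) ∎

  sum-unionUV : (F G : Pt k → ℕ) →
    (∑[ x ← unionUV U V ] 𝟙 (x ∈ᵇ U) * F x + 𝟙 (x ∈ᵇ V) * G x) ≡ sumL U F + sumL V G
  sum-unionUV F G = begin
      sumL (U ++ V∖U) h
    ≡⟨ sum-++ U V∖U h ⟩
      sumL U h + sumL V∖U h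
    ≡⟨ cong₂ _+_ (sum-congAll (All-map onU (∈ᵇ-self U)))
                 (sum-congAll (All-map onV∖U (filter-All notInU (∈ᵇ-self V)))) ⟩
      (∑[ x ← U ] F x + 𝟙 (x ∈ᵇ V) * G x) + sumL V∖U G
    ≡⟨ cong₂ _+_ (sum-+ U F _) (sum-filter notInU V G) ⟩
      (sumL U F + (∑[ x ← U ] 𝟙 (x ∈ᵇ V) * G x)) + (∑[ y ← V ] 𝟙 (notInU y) * G y)
    ≡⟨ cong (λ s → (sumL U F + s) + (∑[ y ← V ] 𝟙 (notInU y) * G y)) (sum-∩ G) ⟩
      (sumL U F + (∑[ y ← V ] 𝟙 (y ∈ᵇ U) * G y)) + (∑[ y ← V ] 𝟙 (notInU y) * G y)
    ≡⟨ +-assoc (sumL U F) _ _ ⟩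
      sumL U F + ((∑[ y ← V ] 𝟙 (y ∈ᵇ U) * G y) + (∑[ y ← V ] 𝟙 (notInU y) * G y))
    ≡⟨ cong (sumL U F +_) (trans (sym (sum-+ V _ _)) (sum-cong V (λ y → 𝟙-split (y ∈ᵇ U) (G y)))) ⟩
      sumL U F + sumL V G ∎
    where
    notInU : Pt k → Bool
    notInU y = not (y ∈ᵇ U)
    V∖U : List (Pt k)
    V∖U = filterᵇ notInU V
    h : Pt k → ℕ
    h x = 𝟙 (x ∈ᵇ U) * F x + 𝟙 (x ∈ᵇ V) * G x
    onU : ∀ {x} → x ∈ᵇ U ≡ true → h x ≡ F x + 𝟙 (x ∈ᵇ V) * G x
    onU {x} inU rewrite inU = cong (_+ _) (+-identityʳ (F x))
    onV∖U : ∀ {x} → notInU x ≡ true × x ∈ᵇ V ≡ true → h x ≡ G x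
    onV∖U {x} (outU , inV) with x ∈ᵇ U
    onV∖U {x} (refl , inV) | false rewrite inV = +-identityʳ (G x)

unionUV-covered : ∀ {k} (U V : List (Pt k)) → All (λ x → (x ∈ᵇ U) ∨ (x ∈ᵇ V) ≡ true) (unionUV U V)
unionUV-covered U V = ++⁺ (All-map (cong (_∨ _)) (∈ᵇ-self U))
  (All-map (λ {y} inV → trans (cong ((y ∈ᵇ U) ∨_) (proj₂ inV)) (∨-zeroʳ _)) (filter-All _ (∈ᵇ-self V)))

-- Weighted counts of confined walks and their first-step decomposition

module _ {k : ℕ} (L : List (Pt k)) (P : Pt k → Bool) (c : Pt k) where

  reaches : ∀ {n} → Pt k → Vec (Pt k) n → Bool
  reaches p w = confinedFrom P p w ∧ ((p ⊕ endpoint w) == c)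

  weightedWalks : (n : ℕ) → (Vec (Pt k) n → ℕ) → Pt k → ℕ
  weightedWalks n ω p = ∑[ w ← seqs n L ] 𝟙 (reaches p w) * ω w

  𝟙-reaches-∷ : ∀ {n} p s (w : Vec (Pt k) n) → 𝟙 (reaches p (s ∷ w)) ≡ 𝟙 (P p) * 𝟙 (reaches (p ⊕ s) w)
  𝟙-reaches-∷ p s w rewrite sym (⊕-assoc p s (endpoint w)) =
    trans (cong 𝟙 (∧-assoc (P p) _ _)) (𝟙-∧ (P p) _)

  firstStep : ∀ n ω p →
    weightedWalks (suc n) ω p ≡ 𝟙 (P p) * (∑[ s ← L ] weightedWalks n (λ w → ω (s ∷ w)) (p ⊕ s))
  firstStep n ω p = begin
      weightedWalks (suc n) ω p
    ≡⟨ sum-seqs-suc n L (λ w → 𝟙 (reaches p w) * ω w) ⟩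
      (∑[ s ← L ] ∑[ w ← seqs n L ] 𝟙 (reaches p (s ∷ w)) * ω (s ∷ w))
    ≡⟨ sum-cong L (λ s → sum-cong (seqs n L) (λ w → factor s w)) ⟩
      (∑[ s ← L ] ∑[ w ← seqs n L ] 𝟙 (P p) * (𝟙 (reaches (p ⊕ s) w) * ω (s ∷ w)))
    ≡⟨ sum-cong L (λ s → sum-* (seqs n L) (𝟙 (P p)) _) ⟩
      (∑[ s ← L ] 𝟙 (P p) * weightedWalks n (λ w → ω (s ∷ w)) (p ⊕ s))
    ≡⟨ sum-* L (𝟙 (P p)) _ ⟩
      𝟙 (P p) * (∑[ s ← L ] weightedWalks n (λ w → ω (s ∷ w)) (p ⊕ s)) ∎
    where
    factor : ∀ s w → 𝟙 (reaches p (s ∷ w)) * ω (s ∷ w) ≡ 𝟙 (P p) * (𝟙 (reaches (p ⊕ s) w) * ω (s ∷ w))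
    factor s w = trans (cong (_* ω (s ∷ w)) (𝟙-reaches-∷ p s w)) (*-assoc (𝟙 (P p)) _ _)

  weightedWalks-cong : ∀ n {ω ω′ : Vec (Pt k) n → ℕ} p → (∀ w → ω w ≡ ω′ w) →
    weightedWalks n ω p ≡ weightedWalks n ω′ p
  weightedWalks-cong n p eq = sum-cong (seqs n L) (λ w → cong (𝟙 (reaches p w) *_) (eq w))

  weightedWalks-linear : ∀ n α β (ω₁ ω₂ : Vec (Pt k) n → ℕ) p →
    weightedWalks n (λ w → α * ω₁ w + β * ω₂ w) p ≡
    α * weightedWalks n ω₁ p + β * weightedWalks n ω₂ p
  weightedWalks-linear n α β ω₁ ω₂ p =
    trans (sum-cong (seqs n L) (λ w → distrib (𝟙 (reaches p w)) α (ω₁ w) β (ω₂ w)))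
          (trans (sum-+ (seqs n L) (λ w → α * (𝟙 (reaches p w) * ω₁ w))
                                   (λ w → β * (𝟙 (reaches p w) * ω₂ w)))
                 (cong₂ _+_ (sum-* (seqs n L) α (λ w → 𝟙 (reaches p w) * ω₁ w))
                            (sum-* (seqs n L) β (λ w → 𝟙 (reaches p w) * ω₂ w))))
    where
    distrib : ∀ g α f β h → g * (α * f + β * h) ≡ α * (g * f) + β * (g * h)
    distrib = solve-∀

  weightedWalks-∑ : ∀ {J : Set} n (js : List J) (ω : J → Vec (Pt k) n → ℕ) p →
    weightedWalks n (λ w → ∑[ j ← js ] ω j w) p ≡ (∑[ j ← js ] weightedWalks n (ω j) p)
  weightedWalks-∑ n js ω p =
    trans (sum-cong (seqs n L) (λ w → sym (sum-* js (𝟙 (reaches p w)) (λ j → ω j w))))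
          (sum-swap (seqs n L) js (λ w j → 𝟙 (reaches p w) * ω j w))

-- The substitution v := T

module Substitution {δ : ℕ} (T : List (Pt δ)) (b : Pt δ) where

  -- the coefficient of y^b in y^q · T(y)^e
  powCoeff : ℕ → Pt δ → ℕ
  powCoeff e q = ∑[ y ← ppow _⊕_ origin T e ] 𝟙 ((q ⊕ y) == b)

  powCoeff-suc : ∀ e q → powCoeff (suc e) q ≡ (∑[ t ← T ] powCoeff e (q ⊕ t))
  powCoeff-suc e q = begin
      powCoeff (suc e) q
    ≡⟨ sum-concatMap (λ t → map (t ⊕_) (ppow _⊕_ origin T e)) T _ ⟩
      (∑[ t ← T ] sumL (map (t ⊕_) (ppow _⊕_ origin T e)) (λ y → 𝟙 ((q ⊕ y) == b)))
    ≡⟨ sum-cong T (λ t → sum-map (t ⊕_) (ppow _⊕_ origin T e) (λ y → 𝟙 ((q ⊕ y) == b))) ⟩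
      (∑[ t ← T ] ∑[ y ← ppow _⊕_ origin T e ] 𝟙 ((q ⊕ (t ⊕ y)) == b))
    ≡⟨ sum-cong T (λ t → sum-cong (ppow _⊕_ origin T e)
                                  (λ y → cong (λ z → 𝟙 (z == b)) (sym (⊕-assoc q t y)))) ⟩
      (∑[ t ← T ] powCoeff e (q ⊕ t)) ∎

  -- the coefficient of y^b in y^q · (1 + T)^k · T^m
  mixedCoeff : ℕ → ℕ → Pt δ → ℕ
  mixedCoeff k m q = ∑[ e ← ppow _+_ 0 onePlusV k ] powCoeff (e + m) q

  mixedCoeff-sucᵐ : ∀ k m q → mixedCoeff k (suc m) q ≡ (∑[ t ← T ] mixedCoeff k m (q ⊕ t))
  mixedCoeff-sucᵐ k m q =
    trans (sum-cong (ppow _+_ 0 onePlusV k)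
                    (λ e → trans (cong (λ z → powCoeff z q) (+-suc e m)) (powCoeff-suc (e + m) q)))
          (sum-swap (ppow _+_ 0 onePlusV k) T (λ e t → powCoeff (e + m) (q ⊕ t)))

  -- (1 + T)^(k+1) T^m = (1 + T)^k T^m + (1 + T)^k T^(m+1)
  mixedCoeff-sucᵏ : ∀ k m q → mixedCoeff (suc k) m q ≡ mixedCoeff k m q + mixedCoeff k (suc m) q
  mixedCoeff-sucᵏ k m q = begin
      mixedCoeff (suc k) m q
    ≡⟨ sum-concatMap (λ e′ → map (e′ +_) B) onePlusV f ⟩
      sumL (map (0 +_) B) f + (sumL (map (1 +_) B) f + 0)
    ≡⟨ cong₂ _+_ (sum-map (0 +_) B f) (trans (+-identityʳ _) (sum-map (1 +_) B f)) ⟩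
      mixedCoeff k m q + (∑[ e ← B ] powCoeff (suc e + m) q)
    ≡⟨ cong (mixedCoeff k m q +_) (sum-cong B (λ e → cong (λ z → powCoeff z q) (sym (+-suc e m)))) ⟩
      mixedCoeff k m q + mixedCoeff k (suc m) q ∎
    where
    B : List ℕ
    B = ppow _+_ 0 onePlusV k
    f : ℕ → ℕ
    f e = powCoeff (e + m) q

  -- a step in U only, V only, or both contributes the factor 1, v or 1 + v;
  -- after v := T this becomes the transfer rule for the exponent q
  mixedCoeff-step : ∀ (inU inV : Bool) → inU ∨ inV ≡ true → ∀ k m q →
    mixedCoeff (𝟙 (inU ∧ inV) + k) (𝟙 (inV ∧ not inU) + m) q ≡
    𝟙 inU * mixedCoeff k m q + 𝟙 inV * (∑[ t ← T ] mixedCoeff k m (q ⊕ t))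
  mixedCoeff-step true  true  _ k m q =
    trans (mixedCoeff-sucᵏ k m q)
          (cong₂ _+_ (sym (+-identityʳ _)) (trans (mixedCoeff-sucᵐ k m q) (sym (+-identityʳ _))))
  mixedCoeff-step true  false _ k m q = sym (trans (+-identityʳ _) (+-identityʳ _))
  mixedCoeff-step false true  _ k m q = trans (mixedCoeff-sucᵐ k m q) (sym (+-identityʳ _))

-- Projecting S-walks onto their first d coordinates

module Projection (d δ : ℕ) (U Vs : List (Pt d)) (T : List (Pt δ)) (a : Pt d) (b : Pt δ) where

  open Substitution T b

  UV : List (Pt d)
  UV = unionUV U Vs

  inBoth inVOnly : Pt d → Bool
  inBoth s  = (s ∈ᵇ U) ∧ (s ∈ᵇ Vs)
  inVOnly s = (s ∈ᵇ Vs) ∧ not (s ∈ᵇ U)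

  weight : ∀ {n} → Vec (Pt d) n → MPoly ℕ
  weight w = pmul _+_ (ppow _+_ 0 onePlusV (countSteps inBoth w)) (countSteps inVOnly w ∷ [])

  -- the coefficient of y^b in y^q · weight(w)(T)
  weightCoeff : ∀ {n} → Vec (Pt d) n → Pt δ → ℕ
  weightCoeff w q = ∑[ e ← weight w ] powCoeff e q

  weightCoeff-mixed : ∀ {n} (w : Vec (Pt d) n) q →
    weightCoeff w q ≡ mixedCoeff (countSteps inBoth w) (countSteps inVOnly w) q
  weightCoeff-mixed w q =
    trans (sum-concatMap (λ e → map (e +_) (countSteps inVOnly w ∷ [])) (ppow _+_ 0 onePlusV (countSteps inBoth w)) _)
          (sum-cong (ppow _+_ 0 onePlusV (countSteps inBoth w))
                    (λ e → +-identityʳ (powCoeff (e + countSteps inVOnly w) q)))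

  weightCoeff-[] : ∀ q → weightCoeff [] q ≡ 𝟙 (q == b)
  weightCoeff-[] q = trans (+-identityʳ _) (trans (+-identityʳ _) (cong (λ z → 𝟙 (z == b)) (⊕-identityʳ q)))

  weightCoeff-step : ∀ {n} x (w : Vec (Pt d) n) q → (x ∈ᵇ U) ∨ (x ∈ᵇ Vs) ≡ true →
    weightCoeff (x ∷ w) q ≡
    𝟙 (x ∈ᵇ U) * weightCoeff w q + 𝟙 (x ∈ᵇ Vs) * (∑[ t ← T ] weightCoeff w (q ⊕ t))
  weightCoeff-step x w q covered = begin
      weightCoeff (x ∷ w) q
    ≡⟨ weightCoeff-mixed (x ∷ w) q ⟩
      mixedCoeff (countSteps inBoth (x ∷ w)) (countSteps inVOnly (x ∷ w)) q
    ≡⟨ cong₂ (λ k′ m′ → mixedCoeff k′ m′ q) (countSteps-∷ inBoth x w) (countSteps-∷ inVOnly x w) ⟩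
      mixedCoeff (𝟙 (inBoth x) + k) (𝟙 (inVOnly x) + m) q
    ≡⟨ mixedCoeff-step (x ∈ᵇ U) (x ∈ᵇ Vs) covered k m q ⟩
      𝟙 (x ∈ᵇ U) * mixedCoeff k m q + 𝟙 (x ∈ᵇ Vs) * (∑[ t ← T ] mixedCoeff k m (q ⊕ t))
    ≡⟨ sym (cong₂ (λ r r′ → 𝟙 (x ∈ᵇ U) * r + 𝟙 (x ∈ᵇ Vs) * r′)
                  (weightCoeff-mixed w q) (sum-cong T (λ t → weightCoeff-mixed w (q ⊕ t)))) ⟩
      𝟙 (x ∈ᵇ U) * weightCoeff w q + 𝟙 (x ∈ᵇ Vs) * (∑[ t ← T ] weightCoeff w (q ⊕ t)) ∎
    where
    k m : ℕ
    k = countSteps inBoth w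
    m = countSteps inVOnly w

  halfSpaceWalks : ℕ → Pt (d + δ) → ℕ
  halfSpaceWalks n p = weightedWalks (stepSetS U Vs T) (inHalf d) (a V.++ b) n (λ _ → 1) p

  decoratedWalks : ℕ → Pt d → Pt δ → ℕ
  decoratedWalks n p q = weightedWalks UV inQuadrant a n (λ w → weightCoeff w q) p

  decoratedWalks-suc : ∀ n p q → decoratedWalks (suc n) p q ≡
    𝟙 (inQuadrant p) * (∑[ x ← UV ] 𝟙 (x ∈ᵇ U) * decoratedWalks n (p ⊕ x) q
                                    + 𝟙 (x ∈ᵇ Vs) * (∑[ t ← T ] decoratedWalks n (p ⊕ x) (q ⊕ t)))
  decoratedWalks-suc n p q =
    trans (firstStep UV inQuadrant a n _ p)
          (cong (𝟙 (inQuadrant p) *_) (sum-congAll (All-map afterStep (unionUV-covered U Vs))))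
    where
    afterStep : ∀ {x} → (x ∈ᵇ U) ∨ (x ∈ᵇ Vs) ≡ true →
      weightedWalks UV inQuadrant a n (λ w → weightCoeff (x ∷ w) q) (p ⊕ x) ≡
      𝟙 (x ∈ᵇ U) * decoratedWalks n (p ⊕ x) q
      + 𝟙 (x ∈ᵇ Vs) * (∑[ t ← T ] decoratedWalks n (p ⊕ x) (q ⊕ t))
    afterStep {x} covered =
      trans (weightedWalks-cong UV inQuadrant a n (p ⊕ x) (λ w → weightCoeff-step x w q covered))
            (trans (weightedWalks-linear UV inQuadrant a n (𝟙 (x ∈ᵇ U)) (𝟙 (x ∈ᵇ Vs)) _ _ (p ⊕ x))
                   (cong (λ r → 𝟙 (x ∈ᵇ U) * decoratedWalks n (p ⊕ x) q + 𝟙 (x ∈ᵇ Vs) * r)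
                         (weightedWalks-∑ UV inQuadrant a n T (λ t w → weightCoeff w (q ⊕ t)) (p ⊕ x))))

  projection : Unique U → Unique Vs → ∀ n p q → halfSpaceWalks n (p V.++ q) ≡ decoratedWalks n p q
  projection uU uV zero p q = cong (_+ 0) (begin
      𝟙 (inHalf d (p V.++ q) ∧ (((p V.++ q) ⊕ origin) == (a V.++ b))) * 1
    ≡⟨ *-identityʳ _ ⟩
      𝟙 (inHalf d (p V.++ q) ∧ (((p V.++ q) ⊕ origin) == (a V.++ b)))
    ≡⟨ cong₂ (λ x y → 𝟙 (allNatᵇ x ∧ y)) (take-++ p q)
             (trans (cong (_== (a V.++ b)) (⊕-identityʳ (p V.++ q))) (==-++ p a q b)) ⟩
      𝟙 (inQuadrant p ∧ ((p == a) ∧ (q == b)))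
    ≡⟨ cong 𝟙 (sym (∧-assoc (inQuadrant p) (p == a) (q == b))) ⟩
      𝟙 ((inQuadrant p ∧ (p == a)) ∧ (q == b))
    ≡⟨ 𝟙-∧ (inQuadrant p ∧ (p == a)) (q == b) ⟩
      𝟙 (inQuadrant p ∧ (p == a)) * 𝟙 (q == b)
    ≡⟨ cong₂ (λ x y → 𝟙 (inQuadrant p ∧ (x == a)) * y) (sym (⊕-identityʳ p)) (sym (weightCoeff-[] q)) ⟩
      𝟙 (inQuadrant p ∧ ((p ⊕ origin) == a)) * weightCoeff [] q ∎)
  projection uU uV (suc n) p q = begin
      halfSpaceWalks (suc n) (p V.++ q)
    ≡⟨ firstStep (stepSetS U Vs T) (inHalf d) (a V.++ b) n _ (p V.++ q) ⟩
      𝟙 (inHalf d (p V.++ q)) * (∑[ s ← stepSetS U Vs T ] halfSpaceWalks n ((p V.++ q) ⊕ s))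
    ≡⟨ cong₂ _*_ (cong (λ z → 𝟙 (allNatᵇ z)) (take-++ p q)) (sum-stepSetS U Vs T _) ⟩
      𝟙 (inQuadrant p) * ((∑[ u ← U ] halfSpaceWalks n ((p V.++ q) ⊕ (u V.++ origin)))
                         + (∑[ v ← Vs ] ∑[ t ← T ] halfSpaceWalks n ((p V.++ q) ⊕ (v V.++ t))))
    ≡⟨ cong (𝟙 (inQuadrant p) *_) (cong₂ _+_ (sum-cong U stepU) (sum-cong Vs (λ v → sum-cong T (stepV v)))) ⟩
      𝟙 (inQuadrant p) * ((∑[ u ← U ] decoratedWalks n (p ⊕ u) q)
                         + (∑[ v ← Vs ] ∑[ t ← T ] decoratedWalks n (p ⊕ v) (q ⊕ t)))
    ≡⟨ cong (𝟙 (inQuadrant p) *_) (sym (sum-unionUV U Vs uU uV _ _)) ⟩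
      𝟙 (inQuadrant p) * (∑[ x ← UV ] 𝟙 (x ∈ᵇ U) * decoratedWalks n (p ⊕ x) q
                                     + 𝟙 (x ∈ᵇ Vs) * (∑[ t ← T ] decoratedWalks n (p ⊕ x) (q ⊕ t)))
    ≡⟨ sym (decoratedWalks-suc n p q) ⟩
      decoratedWalks (suc n) p q ∎
    where
    stepU : ∀ u → halfSpaceWalks n ((p V.++ q) ⊕ (u V.++ origin)) ≡ decoratedWalks n (p ⊕ u) q
    stepU u = trans (cong (halfSpaceWalks n) (trans (⊕-++ p u q origin) (cong ((p ⊕ u) V.++_) (⊕-identityʳ q))))
                    (projection uU uV n (p ⊕ u) q)
    stepV : ∀ v t → halfSpaceWalks n ((p V.++ q) ⊕ (v V.++ t)) ≡ decoratedWalks n (p ⊕ v) (q ⊕ t)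
    stepV v t = trans (cong (halfSpaceWalks n) (⊕-++ p v q t)) (projection uU uV n (p ⊕ v) (q ⊕ t))

  walkCoeffS-origin : ∀ n → walkCoeffS U Vs T n a b ≡ halfSpaceWalks n origin
  walkCoeffS-origin n =
    trans (length-filter _ (seqs n (stepSetS U Vs T)))
          (sum-cong (seqs n (stepSetS U Vs T)) (λ w → sym (trans (*-identityʳ _)
            (cong (λ z → 𝟙 (confined (inHalf d) w ∧ (z == (a V.++ b)))) (⊕-identityˡ (endpoint w))))))

  C1TCoeff-origin : ∀ n → C1TCoeff U Vs T n a b ≡ decoratedWalks n origin origin
  C1TCoeff-origin n = begin
      C1TCoeff U Vs T n a b
    ≡⟨ length-filter (_== b) (concatMap (ppow _⊕_ origin T) (concatMap weight good)) ⟩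
      (∑[ y ← concatMap (ppow _⊕_ origin T) (concatMap weight good) ] 𝟙 (y == b))
    ≡⟨ sum-concatMap (ppow _⊕_ origin T) (concatMap weight good) _ ⟩
      (∑[ e ← concatMap weight good ] ∑[ y ← ppow _⊕_ origin T e ] 𝟙 (y == b))
    ≡⟨ sum-concatMap weight good _ ⟩
      (∑[ w ← good ] ∑[ e ← weight w ] ∑[ y ← ppow _⊕_ origin T e ] 𝟙 (y == b))
    ≡⟨ sum-filter isGood (seqs n UV) _ ⟩
      (∑[ w ← seqs n UV ] 𝟙 (isGood w) * (∑[ e ← weight w ] ∑[ y ← ppow _⊕_ origin T e ] 𝟙 (y == b)))
    ≡⟨ sum-cong (seqs n UV) (λ w → cong₂ _*_
          (cong (λ z → 𝟙 (confined inQuadrant w ∧ (z == a))) (sym (⊕-identityˡ (endpoint w))))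
          (sum-cong (weight w) (λ e → sum-cong (ppow _⊕_ origin T e)
                                       (λ y → cong (λ z → 𝟙 (z == b)) (sym (⊕-identityˡ y)))))) ⟩
      decoratedWalks n origin origin ∎
    where
    isGood : Vec (Pt d) n → Bool
    isGood w = confined inQuadrant w ∧ (endpoint w == a)
    good : List (Vec (Pt d) n)
    good = filterᵇ isGood (seqs n UV)


mainTheorem6 : (d δ : ℕ) → 1 ≤ d → 1 ≤ δ →
    (U Vs : List (Pt d)) (T : List (Pt δ)) →
    Unique U → Unique Vs → Unique T →
    All IsSmallStep U → All IsSmallStep Vs → All IsSmallStep T →
    origin ∉ U → origin ∉ T →
    (n : ℕ) (a : Pt d) (b : Pt δ) →
    walkCoeffS U Vs T n a b ≡ C1TCoeff U Vs T n a b
mainTheorem6 d δ _ _ U Vs T uU uV _ _ _ _ _ _ n a b = begin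
    walkCoeffS U Vs T n a b
  ≡⟨ walkCoeffS-origin n ⟩
    halfSpaceWalks n origin
  ≡⟨ cong (halfSpaceWalks n) (origin-++ d δ) ⟩
    halfSpaceWalks n (origin {d} V.++ origin {δ})
  ≡⟨ projection uU uV n origin origin ⟩
    decoratedWalks n origin origin
  ≡⟨ sym (C1TCoeff-origin n) ⟩
    C1TCoeff U Vs T n a b ∎
  where open Projection d δ U Vs T a b
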